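{- For every positive integer $n$, \[\prod_{i=1}^{\lfloor (n-1)/2 \rfloor}(n-2i)\leq H_n(C_4).\]
   Context: Two graphs on the same vertex set are called $C_4$-creating if the union of their edge sets contains a cycle of length $4$ as a (not necessarily induced) subgraph. $H_n(C_4)$ denotes the maximum number of Hamiltonian paths of the complete graph $K_n$ that are pairwise $C_4$-creating. An empty product equals $1$. -}

module Defs where

open import Data.Nat using (ℕ; zero; suc; _∸_; _*_; _/_; _≤_)
open import Data.Fin using (Fin; toℕ)
open import Data.Fin.Permutation using (Permutation′; _⟨$⟩ʳ_)
open import Data.Product using (Σ; ∃; _×_; _,_)
open import Data.Sum using (_⊎_)
open import Relation.Nullary using (¬_)
open import Relation.Binary.PropositionalEquality using (_≡_; _≢_)
open import Function.Bundles using (_⇔_)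

-- A Hamiltonian path of K_n on vertex set Fin n is given by an ordering
-- of the vertices, i.e. a permutation π; its vertex sequence is
-- π(0), π(1), ..., π(n-1). Two orderings give the same path iff they
-- have the same edge set (i.e. one is the reverse of the other).
HamPath : ℕ → Set
HamPath n = Permutation′ n

PathEdge : {n : ℕ} → HamPath n → Fin n → Fin n → Set
PathEdge {n} π u v =
  Σ (Fin n) λ i → Σ (Fin n) λ j → (toℕ j ≡ suc (toℕ i)) ×
    (((π ⟨$⟩ʳ i ≡ u) × (π ⟨$⟩ʳ j ≡ v)) ⊎ ((π ⟨$⟩ʳ i ≡ v) × (π ⟨$⟩ʳ j ≡ u)))

SamePath : {n : ℕ} → HamPath n → HamPath n → Set
SamePath {n} π σ = (u v : Fin n) → PathEdge π u v ⇔ PathEdge σ u v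

HasC4 : {n : ℕ} → (Fin n → Fin n → Set) → Set
HasC4 {n} E = Σ (Fin n) λ a → Σ (Fin n) λ b → Σ (Fin n) λ c → Σ (Fin n) λ d →
  (a ≢ b) × (a ≢ c) × (a ≢ d) × (b ≢ c) × (b ≢ d) × (c ≢ d) ×
  E a b × E b c × E c d × E d a

C4Creating : {n : ℕ} → HamPath n → HamPath n → Set
C4Creating π σ = HasC4 (λ u v → PathEdge π u v ⊎ PathEdge σ u v)

C4CreatingFamily : (n k : ℕ) → (Fin k → HamPath n) → Set
C4CreatingFamily n k P =
  (i j : Fin k) → i ≢ j → (¬ SamePath (P i) (P j)) × C4Creating (P i) (P j)

-- H_n(C_4) ≥ m  :⇔  some pairwise C4-creating family of size k ≥ m exists
HLowerBound : ℕ → ℕ → Set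
HLowerBound n m = Σ ℕ λ k → (m ≤ k) × Σ (Fin k → HamPath n) λ P → C4CreatingFamily n k P

prodTo : ℕ → ℕ → ℕ
prodTo n zero = 1
prodTo n (suc m) = prodTo n m * (n ∸ 2 * suc m)

lowerProd : ℕ → ℕ
lowerProd n = prodTo n ((n ∸ 1) / 2)

module Submission where

-- A single Hamiltonian path contains no 4-cycle, so two
-- C4-creating paths are automatically different paths; it therefore suffices
-- to build a large family of pairwise C4-creating paths.
--
-- Given a path σ on the vertices of
-- K_{m+1} starting at vertex 0 and a vertex c of K_{m+1}, the path
-- `extend c σ` on K_{m+3} runs  0, c', σ'(0), σ'(1), ...  where c' = c + 2
-- is a new copy of c and x' = relabel c x embeds the old vertices into the
-- remaining ones, with the old start 0 sent to vertex 1.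
--   * If c ≢ d, then  0 – c' – 1 – d' – 0  is a C4 in the union of
--     `extend c σ` and `extend d τ`.
--   * If c ≡ d, a C4 created by σ and τ is copied along the embedding.
-- Hence from a pairwise C4-creating family of size k on K_{m+1} we get one of
-- size (m+1)·k on K_{m+3}.  Starting from a single path for n ≤ 2, this gives
-- a family of size (n-2)(n-4)···, which is exactly  lowerProd n.

open import Defs
open import Data.Nat using (ℕ; zero; suc; _*_; _∸_; _/_; _≤_; s≤s; z≤n)
open import Data.Nat.Properties using (*-identityʳ; +-identityʳ; *-suc; *-assoc; ≤-reflexive)
open import Data.Nat.DivMod using (m/n≡1+[m∸n]/n)
open import Data.Fin using (Fin; toℕ; punchIn; remQuot; combine; _≟_) renaming (zero to fz; suc to fs)
open import Data.Fin.Properties using (toℕ-injective; punchIn-injective; suc-injective; combine-remQuot)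
open import Data.Fin.Permutation using (_⟨$⟩ʳ_; _⟨$⟩ˡ_; _∘ₚ_; lift₀; insert; id; inverseˡ; inverseʳ)
open import Data.Product using (_×_; _,_; proj₁; proj₂; uncurry)
open import Data.Sum using (inj₁; inj₂; [_,_])
open import Data.Empty using (⊥; ⊥-elim)
open import Relation.Nullary using (¬_; yes; no)
open import Relation.Binary.PropositionalEquality using (_≡_; _≢_; refl; sym; trans; cong; cong₂; module ≡-Reasoning)
open import Function.Bundles using (Equivalence)

data Consecutive : ℕ → ℕ → Set where
  up   : ∀ {x} → Consecutive x (suc x)
  down : ∀ {x} → Consecutive (suc x) x

-- The path graph on ℕ has no 4-cycle: a closed walk p q r s p of consecutive
-- steps must revisit a vertex two steps apart.
no-C4-on-a-line : ∀ {p q r s} → Consecutive p q → Consecutive q r →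
                  Consecutive r s → Consecutive s p → p ≢ r → q ≢ s → ⊥
no-C4-on-a-line up   up   up   ()
no-C4-on-a-line up   up   down down p≢r q≢s = q≢s refl
no-C4-on-a-line up   down _    _    p≢r q≢s = p≢r refl
no-C4-on-a-line down up   _    _    p≢r q≢s = p≢r refl
no-C4-on-a-line down down up   up   p≢r q≢s = q≢s refl
no-C4-on-a-line down down down ()

module Positions {n : ℕ} (π : HamPath n) where

  position : Fin n → Fin n
  position u = π ⟨$⟩ˡ u

  position-injective : ∀ {u v} → position u ≡ position v → u ≡ v
  position-injective e = trans (sym (inverseʳ π)) (trans (cong (π ⟨$⟩ʳ_) e) (inverseʳ π))

  position-of : ∀ {i u} → π ⟨$⟩ʳ i ≡ u → position u ≡ i
  position-of refl = inverseˡ π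

  edge⇒consecutive : ∀ {u v} → PathEdge π u v →
                     Consecutive (toℕ (position u)) (toℕ (position v))
  edge⇒consecutive (i , j , j≡1+i , inj₁ (πi≡u , πj≡v))
    rewrite position-of πi≡u | position-of πj≡v | j≡1+i = up
  edge⇒consecutive (i , j , j≡1+i , inj₂ (πi≡v , πj≡u))
    rewrite position-of πi≡v | position-of πj≡u | j≡1+i = down

  path-has-no-C4 : ¬ HasC4 (PathEdge π)
  path-has-no-C4 (a , b , c , d , _ , a≢c , _ , _ , b≢d , _ , ab , bc , cd , da) =
    no-C4-on-a-line (edge⇒consecutive ab) (edge⇒consecutive bc)
                    (edge⇒consecutive cd) (edge⇒consecutive da)
                    (λ e → a≢c (position-injective (toℕ-injective e)))
                    (λ e → b≢d (position-injective (toℕ-injective e)))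

open Positions using (path-has-no-C4)

map-C4 : ∀ {m n} {E : Fin m → Fin m → Set} {F : Fin n → Fin n → Set}
         (f : Fin m → Fin n) → (∀ {x y} → f x ≡ f y → x ≡ y) →
         (∀ {u v} → E u v → F (f u) (f v)) → HasC4 E → HasC4 F
map-C4 f f-inj f-edge (a , b , c , d , ab , ac , ad , bc , bd , cd , e₁ , e₂ , e₃ , e₄) =
  f a , f b , f c , f d ,
  (λ e → ab (f-inj e)) , (λ e → ac (f-inj e)) , (λ e → ad (f-inj e)) ,
  (λ e → bc (f-inj e)) , (λ e → bd (f-inj e)) , (λ e → cd (f-inj e)) ,
  f-edge e₁ , f-edge e₂ , f-edge e₃ , f-edge e₄

-- If two paths create a C4 they are different: otherwise the C4 would lie
-- in the edge set of a single path.
C4Creating⇒¬SamePath : ∀ {n} (π σ : HamPath n) → C4Creating π σ → ¬ SamePath π σ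
C4Creating⇒¬SamePath π σ c4 same =
  path-has-no-C4 π (map-C4 (λ x → x) (λ e → e) (λ {u} {v} → [ (λ e → e) , Equivalence.from (same u v) ]) c4)

-- Embedding of the vertices of K_m into K_{m+2} avoiding vertex 0 and the
-- copy c + 2 of c; vertex 0 is sent to vertex 1.
relabel : ∀ {m} → Fin m → Fin m → Fin (suc (suc m))
relabel c x = fs (punchIn (fs c) x)

relabel-injective : ∀ {m} (c : Fin m) {x y} → relabel c x ≡ relabel c y → x ≡ y
relabel-injective c {x} {y} e = punchIn-injective (fs c) x y (suc-injective e)

-- The path  0, c + 2, relabel c (σ 0), relabel c (σ 1), ...
extend : ∀ {m} → Fin m → HamPath m → HamPath (suc (suc m))
extend c σ = lift₀ (lift₀ σ) ∘ₚ lift₀ (insert fz (fs c) id)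

extend-edge : ∀ {m} (c : Fin m) (σ : HamPath m) {u v} →
              PathEdge σ u v → PathEdge (extend c σ) (relabel c u) (relabel c v)
extend-edge c σ (i , j , j≡1+i , inj₁ (σi≡u , σj≡v)) =
  fs (fs i) , fs (fs j) , cong (λ x → suc (suc x)) j≡1+i ,
  inj₁ (cong (relabel c) σi≡u , cong (relabel c) σj≡v)
extend-edge c σ (i , j , j≡1+i , inj₂ (σi≡v , σj≡u)) =
  fs (fs i) , fs (fs j) , cong (λ x → suc (suc x)) j≡1+i ,
  inj₂ (cong (relabel c) σi≡v , cong (relabel c) σj≡u)

extend-same-vertex : ∀ {m} (c : Fin m) (σ τ : HamPath m) →
                     C4Creating σ τ → C4Creating (extend c σ) (extend c τ)
extend-same-vertex c σ τ =
  map-C4 (relabel c) (relabel-injective c)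
         [ (λ e → inj₁ (extend-edge c σ e)) , (λ e → inj₂ (extend-edge c τ e)) ]

StartsAtZero : ∀ {m} → HamPath (suc m) → Set
StartsAtZero σ = σ ⟨$⟩ʳ fz ≡ fz

-- Extending paths that start at 0 at two different vertices c, d creates
-- the 4-cycle  0 – (c+2) – 1 – (d+2) – 0.
extend-different-vertices : ∀ {m} (c d : Fin (suc m)) (σ τ : HamPath (suc m)) →
                            StartsAtZero σ → StartsAtZero τ → c ≢ d →
                            C4Creating (extend c σ) (extend d τ)
extend-different-vertices c d σ τ σ₀ τ₀ c≢d =
  fz , fs (fs c) , fs fz , fs (fs d) ,
  (λ ()) , (λ ()) , (λ ()) , (λ ()) , (λ e → c≢d (suc-injective (suc-injective e))) , (λ ()) ,
  inj₁ (fz , fs fz , refl , inj₁ (refl , refl)) ,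
  inj₁ (fs fz , fs (fs fz) , refl , inj₁ (refl , cong (relabel c) σ₀)) ,
  inj₂ (fs fz , fs (fs fz) , refl , inj₂ (refl , cong (relabel d) τ₀)) ,
  inj₂ (fz , fs fz , refl , inj₂ (refl , refl))

PairwiseC4Creating : ∀ {n k} → (Fin k → HamPath n) → Set
PairwiseC4Creating {k = k} P = (i j : Fin k) → i ≢ j → C4Creating (P i) (P j)

singleton-pairwise : ∀ {n} (P : Fin 1 → HamPath n) → PairwiseC4Creating P
singleton-pairwise P fz fz fz≢fz = ⊥-elim (fz≢fz refl)

remQuot-injective : ∀ {m} k {i j : Fin (m * k)} → remQuot {m} k i ≡ remQuot k j → i ≡ j
remQuot-injective {m} k {i} {j} e =
  trans (sym (combine-remQuot {m} k i)) (trans (cong (uncurry combine) e) (combine-remQuot {m} k j))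

extend-pairwise : ∀ {m k} (P : Fin k → HamPath (suc m)) → (∀ t → StartsAtZero (P t)) →
                  PairwiseC4Creating P → (ct du : Fin (suc m) × Fin k) → ct ≢ du →
                  C4Creating (extend (proj₁ ct) (P (proj₂ ct))) (extend (proj₁ du) (P (proj₂ du)))
extend-pairwise P P₀ pairwise (c , t) (d , u) ct≢du with c ≟ d
... | no c≢d   = extend-different-vertices c d (P t) (P u) (P₀ t) (P₀ u) c≢d
... | yes refl = extend-same-vertex c (P t) (P u) (pairwise t u t≢u)
  where
  t≢u : t ≢ u
  t≢u refl = ct≢du refl

extendAll : ∀ {m k} → (Fin k → HamPath (suc m)) → Fin (suc m * k) → HamPath (suc (suc (suc m)))
extendAll {m} {k} P i = extend (proj₁ (remQuot {suc m} k i)) (P (proj₂ (remQuot {suc m} k i)))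

extendAll-pairwise : ∀ {m k} (P : Fin k → HamPath (suc m)) → (∀ t → StartsAtZero (P t)) →
                     PairwiseC4Creating P → PairwiseC4Creating (extendAll P)
extendAll-pairwise {m} {k} P P₀ pairwise i j i≢j =
  extend-pairwise P P₀ pairwise (remQuot {suc m} k i) (remQuot {suc m} k j)
                  (λ e → i≢j (remQuot-injective k e))

familySize : ℕ → ℕ
familySize (suc (suc (suc m))) = suc m * familySize (suc m)
familySize _                   = 1

family : (n : ℕ) → Fin (familySize n) → HamPath n
family (suc (suc (suc m))) = extendAll (family (suc m))
family zero                = λ _ → id
family (suc zero)          = λ _ → id
family (suc (suc zero))    = λ _ → id

family-startsAtZero : ∀ m (i : Fin (familySize (suc m))) → StartsAtZero (family (suc m) i)
family-startsAtZero zero           i = refl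
family-startsAtZero (suc zero)     i = refl
family-startsAtZero (suc (suc m))  i = refl

family-pairwise : ∀ n → PairwiseC4Creating (family n)
family-pairwise zero                = singleton-pairwise (family 0)
family-pairwise (suc zero)          = singleton-pairwise (family 1)
family-pairwise (suc (suc zero))    = singleton-pairwise (family 2)
family-pairwise (suc (suc (suc m))) =
  extendAll-pairwise (family (suc m)) (family-startsAtZero m) (family-pairwise (suc m))

prodTo-shift : ∀ k j → prodTo (suc (suc k)) (suc j) ≡ k * prodTo k j
prodTo-shift k zero = trans (+-identityʳ k) (sym (*-identityʳ k))
prodTo-shift k (suc j) = begin
  prodTo (suc (suc k)) (suc j) * (suc (suc k) ∸ 2 * suc (suc j))
    ≡⟨ cong₂ _*_ (prodTo-shift k j) (cong (suc (suc k) ∸_) (*-suc 2 (suc j))) ⟩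
  k * prodTo k j * (k ∸ 2 * suc j)
    ≡⟨ *-assoc k (prodTo k j) (k ∸ 2 * suc j) ⟩
  k * prodTo k (suc j) ∎
  where open ≡-Reasoning

familySize-correct : ∀ n → familySize n ≡ lowerProd n
familySize-correct zero             = refl
familySize-correct (suc zero)       = refl
familySize-correct (suc (suc zero)) = refl
familySize-correct (suc (suc (suc m))) = begin
  suc m * familySize (suc m)
    ≡⟨ cong (suc m *_) (familySize-correct (suc m)) ⟩
  suc m * prodTo (suc m) (m / 2)
    ≡⟨ prodTo-shift (suc m) (m / 2) ⟨
  prodTo (suc (suc (suc m))) (suc (m / 2))
    ≡⟨ cong (prodTo (suc (suc (suc m)))) (m/n≡1+[m∸n]/n {suc (suc m)} {2} (s≤s (s≤s z≤n))) ⟨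
  lowerProd (suc (suc (suc m))) ∎
  where open ≡-Reasoning

lemma2p1 : (n : ℕ) → 1 ≤ n → HLowerBound n (lowerProd n)
lemma2p1 n _ =
  familySize n , ≤-reflexive (sym (familySize-correct n)) , family n ,
  λ i j i≢j → let c4 = family-pairwise n i j i≢j in
              C4Creating⇒¬SamePath (family n i) (family n j) c4 , c4
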